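{- Let $\mathcal C$ be a class of graphs closed under taking (not necessarily induced) subgraphs and under isomorphism. If $\mathcal C$ is dependent, then $\mathcal C$ is superflat.
   Context: Graphs are undirected, loopless, without multiple edges, not necessarily finite, viewed as structures with one binary relation $E$. $K_m^r$ denotes the complete graph $K_m$ with every edge subdivided exactly $r$ times; a class of graphs is superflat if for every $r\ge0$ there is an $m$ such that $K_m^r$ is not isomorphic to a subgraph of any member. A first-order formula $\phi(\bar x,\bar y)$ has the independence property with respect to a class $\mathcal C$ of structures if for every $n$ there are $M\in\mathcal C$, tuples $\bar a_0,\dots,\bar a_{n-1}$ in $M$ and tuples $\bar b_J$ in $M$ for every $J\subseteq\{0,\dots,n-1\}$ such that $M\models\phi(\bar a_i,\bar b_J)$ iff $i\in J$. $\mathcal C$ is dependent if no first-order formula has the independence property with respect to $\mathcal C$. -}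

module Defs where

open import Level using (0ℓ)
open import Data.Nat using (ℕ; zero; suc; _+_)
open import Data.Nat.Properties using (1+n≢n)
open import Data.Fin using (Fin; toℕ; _<_)
open import Data.Fin.Properties using (<-irrefl)
open import Data.Fin.Subset using (Subset; _∈_)
open import Data.Vec.Functional using (_++_; _∷_)
open import Data.Product using (Σ; Σ-syntax; _×_; _,_)
open import Data.Sum using (_⊎_; inj₁; inj₂)
open import Data.Empty using (⊥)
open import Relation.Nullary using (¬_)
open import Relation.Binary.PropositionalEquality using (_≡_; refl)
open import Function.Bundles using (_⇔_)

record Graph : Set₁ where
  field
    V     : Set
    E     : V → V → Set
    E-sym : ∀ {x y} → E x y → E y x
    E-irr : ∀ {x} → ¬ E x x
open Graph public

-- H is isomorphic to a (not necessarily induced) subgraph of G: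
-- an injective map on vertices sending edges to edges.
record _↪_ (H G : Graph) : Set where
  field
    map   : V H → V G
    inj   : ∀ {x y} → map x ≡ map y → x ≡ y
    edges : ∀ {x y} → E H x y → E G (map x) (map y)

record _≅_ (H G : Graph) : Set where
  field
    to      : V H → V G
    from    : V G → V H
    from∘to : ∀ x → from (to x) ≡ x
    to∘from : ∀ y → to (from y) ≡ y
    edges   : ∀ {x y} → E H x y ⇔ E G (to x) (to y)

Class : Set₁
Class = Graph → Set

IsoClosed : Class → Set₁
IsoClosed C = ∀ G H → C G → H ≅ G → C H

SubgraphClosed : Class → Set₁
SubgraphClosed C = ∀ G H → C G → H ↪ G → C H

-- K_m^r : the complete graph K_m with every edge subdivided r times.  For i < j the edge ij is
-- replaced by the path prin i, sub i j 0, ..., sub i j (r-1), prin j.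

data KV (m r : ℕ) : Set where
  prin : Fin m → KV m r
  sub  : (i j : Fin m) → i < j → Fin r → KV m r

data KD {m r : ℕ} : KV m r → KV m r → Set where
  direct : ∀ {i j} (p : i < j) → r ≡ 0 → KD (prin i) (prin j)
  first  : ∀ {i j} (p : i < j) (k : Fin r) → toℕ k ≡ 0 →
           KD (prin i) (sub i j p k)
  mid    : ∀ {i j} (p : i < j) (k l : Fin r) → suc (toℕ k) ≡ toℕ l →
           KD (sub i j p k) (sub i j p l)
  last   : ∀ {i j} (p : i < j) (k : Fin r) → suc (toℕ k) ≡ r →
           KD (sub i j p k) (prin j)

KD-irr : ∀ {m r} {x : KV m r} → ¬ KD x x
KD-irr (direct p _) = <-irrefl refl p
KD-irr (mid p k .k e) = 1+n≢n e

KE : ∀ {m r} → KV m r → KV m r → Set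
KE x y = KD x y ⊎ KD y x

KE-sym : ∀ {m r} {x y : KV m r} → KE x y → KE y x
KE-sym (inj₁ d) = inj₂ d
KE-sym (inj₂ d) = inj₁ d

KE-irr : ∀ {m r} {x : KV m r} → ¬ KE x x
KE-irr (inj₁ d) = KD-irr d
KE-irr (inj₂ d) = KD-irr d

K : (m r : ℕ) → Graph
K m r = record { V = KV m r ; E = KE ; E-sym = KE-sym ; E-irr = KE-irr }

Superflat : Class → Set₁
Superflat C = ∀ (r : ℕ) → Σ[ m ∈ ℕ ] (∀ G → C G → ¬ (K m r ↪ G))

-- First-order logic in the language {E} (with equality).
-- Formula n: formulas whose free variables are among Fin n (de Bruijn).

data Formula : ℕ → Set where
  rel  : ∀ {n} → Fin n → Fin n → Formula n
  eq   : ∀ {n} → Fin n → Fin n → Formula n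
  neg  : ∀ {n} → Formula n → Formula n
  conj : ∀ {n} → Formula n → Formula n → Formula n
  ex   : ∀ {n} → Formula (suc n) → Formula n

Sat : (G : Graph) {n : ℕ} → (Fin n → V G) → Formula n → Set
Sat G ρ (rel x y)  = E G (ρ x) (ρ y)
Sat G ρ (eq x y)   = ρ x ≡ ρ y
Sat G ρ (neg φ)    = ¬ Sat G ρ φ
Sat G ρ (conj φ ψ) = Sat G ρ φ × Sat G ρ ψ
Sat G ρ (ex φ)     = Σ[ v ∈ V G ] Sat G (v ∷ ρ) φ

HasIP : Class → (k l : ℕ) → Formula (k + l) → Set₁
HasIP C k l φ =
  ∀ (n : ℕ) → Σ[ M ∈ Graph ] (C M ×
    Σ[ a ∈ (Fin n → Fin k → V M) ] Σ[ b ∈ (Subset n → Fin l → V M) ]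
      (∀ (i : Fin n) (J : Subset n) → (Sat M (a i ++ b J) φ ⇔ (i ∈ J))))

Dependent : Class → Set₁
Dependent C = ∀ (k l : ℕ) (φ : Formula (k + l)) → ¬ HasIP C k l φ

-- Suppose C is not superflat: for some r, every K_m^r is a subgraph of a
-- member of C.  We show that the formula
--     reach_r(x, y) = "x and y are joined by a non-backtracking walk of
--                      length r + 1"
-- has the independence property with respect to C.  Given n, take
-- m = n + 2^n principal vertices: a_i (i < n) and b_c (c < 2^n, c encoding
-- a subset J_c of {0..n-1}), and delete from K_m^r every subdivided edge
-- except those a_i — b_c with i ∈ J_c.  In the resulting graph a
-- non-backtracking walk of length r + 1 starting at a_i cannot turn back
-- inside a subdivided path, so it runs along one of them and ends exactly
-- at some b_c with i ∈ J_c; conversely each kept path is such a walk.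
-- The pruned graph embeds into K_m^r, hence into a member of C, and C is
-- subgraph closed.

module Submission where

open import Defs
open import Level using (Level)
open import Axiom.ExcludedMiddle using (ExcludedMiddle)

open import Data.Nat as ℕ using (ℕ; zero; suc; _+_; _^_)
open import Data.Nat.Properties using (+-suc; +-identityʳ; suc-injective; 1+n≢0; m≢1+n+m; m≤m+n; m≤n+m; <-≤-trans)
open import Data.Fin as F using (Fin; toℕ; fromℕ<; _↑ˡ_; _↑ʳ_; splitAt; funToFin; finToFun)
open import Data.Fin.Properties using (toℕ-injective; toℕ-fromℕ<; toℕ-↑ˡ; toℕ-↑ʳ; toℕ<n; ↑ˡ-injective; ↑ʳ-injective; splitAt-↑ˡ; splitAt-↑ʳ; <-irrefl; finToFun-funToFin)
open import Data.Fin.Subset using (Subset; _∈_)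
open import Data.Vec using (lookup; tabulate)
open import Data.Vec.Properties using (tabulate-cong; tabulate∘lookup)
open import Data.Bool using (Bool; true; false)
open import Data.Product using (Σ; Σ-syntax; _×_; _,_; uncurry)
open import Data.Sum using (_⊎_; inj₁; inj₂)
open import Data.Empty using (⊥-elim)
open import Relation.Nullary using (¬_; yes; no)
open import Relation.Binary.PropositionalEquality using (_≡_; refl; sym; trans; cong; subst; subst₂; module ≡-Reasoning)
open import Function.Bundles using (_⇔_; mk⇔; Equivalence)
import Data.Vec.Functional as VF

-- NBWalk G k w x y: a walk x = v₀, v₁, …, v_k = y in G whose first step
-- avoids w and in which no step returns to the vertex two steps back.
NBWalk : (G : Graph) → ℕ → V G → V G → V G → Set
NBWalk G zero    w x y = x ≡ y
NBWalk G (suc k) w x y = Σ[ z ∈ V G ] (E G x z × ¬ z ≡ w × NBWalk G k x z y)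

nbWalkF : ∀ {n} → ℕ → Fin n → Fin n → Fin n → Formula n
nbWalkF zero    w x y = eq x y
nbWalkF (suc k) w x y =
  ex (conj (rel (F.suc x) F.zero)
      (conj (neg (eq F.zero (F.suc w))) (nbWalkF k (F.suc x) F.zero (F.suc y))))

sat-nbWalk : (G : Graph) (k : ℕ) {n : ℕ} (ρ : Fin n → V G) (w x y : Fin n) →
             Sat G ρ (nbWalkF k w x y) ⇔ NBWalk G k (ρ w) (ρ x) (ρ y)
sat-nbWalk G k ρ w x y = mk⇔ (to k ρ w x y) (from k ρ w x y)
  where
  to : (k : ℕ) {n : ℕ} (ρ : Fin n → V G) (w x y : Fin n) →
       Sat G ρ (nbWalkF k w x y) → NBWalk G k (ρ w) (ρ x) (ρ y)
  to zero    ρ w x y s = s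
  to (suc k) ρ w x y (v , e , ne , s) = v , e , ne , to k (v VF.∷ ρ) (F.suc x) F.zero (F.suc y) s
  from : (k : ℕ) {n : ℕ} (ρ : Fin n → V G) (w x y : Fin n) →
         NBWalk G k (ρ w) (ρ x) (ρ y) → Sat G ρ (nbWalkF k w x y)
  from zero    ρ w x y s = s
  from (suc k) ρ w x y (v , e , ne , s) = v , e , ne , from k (v VF.∷ ρ) (F.suc x) F.zero (F.suc y) s

Reach : (G : Graph) → ℕ → V G → V G → Set
Reach G r x y = Σ[ z ∈ V G ] (E G x z × NBWalk G r x z y)

reachF : ℕ → Formula (1 + 1)
reachF r = ex (conj (rel (F.suc F.zero) F.zero) (nbWalkF r (F.suc F.zero) F.zero (F.suc (F.suc F.zero))))

sat-reach : (G : Graph) (r : ℕ) (ρ : Fin 2 → V G) →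
            Sat G ρ (reachF r) ⇔ Reach G r (ρ F.zero) (ρ (F.suc F.zero))
sat-reach G r ρ = mk⇔
  (λ { (z , e , s) → z , e , Equivalence.to   (walk z) s })
  (λ { (z , e , s) → z , e , Equivalence.from (walk z) s })
  where
  walk : (z : V G) → Sat G (z VF.∷ ρ) (nbWalkF r (F.suc F.zero) F.zero (F.suc (F.suc F.zero)))
                     ⇔ NBWalk G r (ρ F.zero) z (ρ (F.suc F.zero))
  walk z = sat-nbWalk G r (z VF.∷ ρ) (F.suc F.zero) F.zero (F.suc (F.suc F.zero))

ends : ∀ {m r} {x y : KV m r} → KD x y → Fin m × Fin m
ends (direct {i} {j} _ _)  = i , j
ends (first  {i} {j} _ _ _) = i , j
ends (mid    {i} {j} _ _ _ _) = i , j
ends (last   {i} {j} _ _ _) = i , j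

sub-index-injective : ∀ {m r} {i j : Fin m} {p : i F.< j} {k l : Fin r} →
                      sub i j p k ≡ sub i j p l → k ≡ l
sub-index-injective refl = refl

Source : ∀ {m} → (Fin m → Fin m → Set) → Fin m → Set
Source R I = ∀ {a} → ¬ R a I

module Pruned {m : ℕ} (R : Fin m → Fin m → Set) where

  KeptE : ∀ {r} → KV m r → KV m r → Set
  KeptE x y = (Σ (KD x y) λ d → uncurry R (ends d)) ⊎ (Σ (KD y x) λ d → uncurry R (ends d))

  KR : ℕ → Graph
  KR r = record
    { V     = KV m r
    ; E     = KeptE
    ; E-sym = λ { (inj₁ d) → inj₂ d ; (inj₂ d) → inj₁ d }
    ; E-irr = λ { (inj₁ (d , _)) → KD-irr d ; (inj₂ (d , _)) → KD-irr d }
    }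

  KR↪K : ∀ r → KR r ↪ K m r
  KR↪K r = record
    { map   = λ x → x
    ; inj   = λ e → e
    ; edges = λ { (inj₁ (d , _)) → inj₁ d ; (inj₂ (d , _)) → inj₂ d }
    }

  -- Pred p k w: w is the vertex preceding the k-th inner vertex of the
  -- subdivided path from prin I to prin Q (so a walk there moves forward).
  data Pred {r} {I Q : Fin m} (p : I F.< Q) : Fin r → KV m r → Set where
    at-start : ∀ {k} → toℕ k ≡ 0 → Pred p k (prin I)
    inside   : ∀ {k k'} → suc (toℕ k') ≡ toℕ k → Pred p k (sub I Q p k')

  follow : ∀ {r} {I Q : Fin m} (p : I F.< Q) (s : ℕ) (k : Fin r) {w} {j} →
           Pred p k w → s + toℕ k ≡ r → NBWalk (KR r) s w (sub I Q p k) (prin j) → j ≡ Q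
  follow p zero k _ _ ()
  follow p (suc s) k _ len (_ , inj₁ (mid _ _ l e , _) , _ , rest) =
    follow p s l (inside e) (trans (trans (cong (s +_) (sym e)) (+-suc s (toℕ k))) len) rest
  follow p (suc zero) k _ _ (_ , inj₁ (last _ _ _ , _) , _ , refl) = refl
  follow p (suc (suc s)) k _ len (_ , inj₁ (last _ _ e , _) , _ , _) =
    ⊥-elim (m≢1+n+m (toℕ k) (sym (suc-injective (trans len (sym e)))))
  follow p (suc s) k (at-start _) _ (_ , inj₂ (first _ _ _ , _) , ne , _) = ⊥-elim (ne refl)
  follow p (suc s) k (inside e') _ (_ , inj₂ (first _ _ e , _) , _ , _) = ⊥-elim (1+n≢0 (trans e' e))
  follow p (suc s) k (at-start k0) _ (_ , inj₂ (mid _ _ _ e , _) , _ , _) = ⊥-elim (1+n≢0 (trans e k0))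
  follow p (suc s) k (inside e') _ (_ , inj₂ (mid _ _ _ e , _) , ne , _) =
    ⊥-elim (ne (cong (sub _ _ p) (toℕ-injective (suc-injective (trans e (sym e'))))))

  advance : ∀ {r} {I Q : Fin m} (p : I F.< Q) → R I Q → ∀ (s : ℕ) (k : Fin r) {w} →
            Pred p k w → suc s + toℕ k ≡ r → NBWalk (KR r) (suc s) w (sub I Q p k) (prin Q)
  advance {r} {I} {Q} p kept zero k pred len = prin Q , inj₁ (last p k len , kept) , end≢pred pred , refl
    where
    end≢pred : ∀ {w} → Pred p k w → ¬ prin Q ≡ w
    end≢pred (at-start _) refl = <-irrefl refl p
    end≢pred (inside _) ()
  advance {r} {I} {Q} p kept (suc s) k pred len =
    sub I Q p l , inj₁ (mid p k l (sym tl) , kept) , next≢pred pred ,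
    advance p kept s l (inside (sym tl)) len'
    where
    l<r : suc (toℕ k) ℕ.< r
    l<r = subst (suc (toℕ k) ℕ.<_) len (ℕ.s≤s (ℕ.s≤s (m≤n+m (toℕ k) s)))
    l : Fin r
    l = fromℕ< l<r
    tl : toℕ l ≡ suc (toℕ k)
    tl = toℕ-fromℕ< l<r
    len' : suc s + toℕ l ≡ r
    len' = trans (cong (suc s +_) tl) (trans (cong suc (+-suc s (toℕ k))) len)
    next≢pred : ∀ {w} → Pred p k w → ¬ sub I Q p l ≡ w
    next≢pred (at-start _) ()
    next≢pred (inside {k' = k'} e') e =
      m≢1+n+m (toℕ k') (sym (trans (cong suc e') (trans (sym tl) (cong toℕ (sub-index-injective e)))))

  reach-of-kept : ∀ {r} {I Q : Fin m} → I F.< Q → R I Q → Reach (KR r) r (prin I) (prin Q)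
  reach-of-kept {zero}  p kept = prin _ , inj₁ (direct p refl , kept) , refl
  reach-of-kept {suc r} p kept =
    sub _ _ p F.zero , inj₁ (first p F.zero refl , kept) ,
    advance p kept r F.zero (at-start refl) (cong suc (+-identityʳ r))

  kept-of-reach : ∀ {r} {I j : Fin m} → Source R I → Reach (KR r) r (prin I) (prin j) → R I j
  kept-of-reach src (_ , inj₁ (direct p refl , kept) , refl) = kept
  kept-of-reach {r} {I} src (_ , inj₁ (first p k e , kept) , walk) =
    subst (R I) (sym (follow p r k (at-start e) (trans (cong (r +_) e) (+-identityʳ r)) walk)) kept
  kept-of-reach src (_ , inj₂ (direct _ _ , kept) , _) = ⊥-elim (src kept)
  kept-of-reach src (_ , inj₂ (last _ _ _ , kept) , _) = ⊥-elim (src kept)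

Bipartite : ∀ {k l} → (Fin k → Fin l → Set) → Fin (k + l) → Fin (k + l) → Set
Bipartite {k} {l} R p q = Σ[ i ∈ Fin k ] Σ[ c ∈ Fin l ] (p ≡ i ↑ˡ l × q ≡ k ↑ʳ c × R i c)

left-source : ∀ {k l} (R : Fin k → Fin l → Set) (i : Fin k) → Source (Bipartite R) (i ↑ˡ l)
left-source {k} {l} R i (_ , c , _ , e , _)
  with trans (sym (splitAt-↑ˡ k i l)) (trans (cong (splitAt k) e) (splitAt-↑ʳ k l c))
... | ()

left<right : ∀ {k l} (i : Fin k) (c : Fin l) → i ↑ˡ l F.< k ↑ʳ c
left<right {k} {l} i c =
  subst₂ ℕ._<_ (sym (toℕ-↑ˡ i l)) (sym (toℕ-↑ʳ k c)) (<-≤-trans (toℕ<n i) (m≤m+n k (toℕ c)))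

bipartite⇒rel : ∀ {k l} (R : Fin k → Fin l → Set) (i : Fin k) (c : Fin l) →
                Bipartite R (i ↑ˡ l) (k ↑ʳ c) → R i c
bipartite⇒rel {k} {l} R i c (i' , c' , ei , ec , related)
  with ↑ˡ-injective l i i' ei | ↑ʳ-injective k c c' ec
... | refl | refl = related

bit : Bool → Fin 2
bit false = F.zero
bit true  = F.suc F.zero

unbit : Fin 2 → Bool
unbit F.zero    = false
unbit (F.suc _) = true

encode : ∀ {n} → Subset n → Fin (2 ^ n)
encode J = funToFin (λ i → bit (lookup J i))

decode : ∀ {n} → Fin (2 ^ n) → Subset n
decode c = tabulate (λ i → unbit (finToFun c i))

unbit∘bit : ∀ b → unbit (bit b) ≡ b
unbit∘bit false = refl
unbit∘bit true  = refl

decode-encode : ∀ {n} (J : Subset n) → decode (encode J) ≡ J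
decode-encode J = begin
  tabulate (λ i → unbit (finToFun (funToFin (λ i → bit (lookup J i))) i))
    ≡⟨ tabulate-cong (λ i → cong unbit (finToFun-funToFin (λ i → bit (lookup J i)) i)) ⟩
  tabulate (λ i → unbit (bit (lookup J i)))
    ≡⟨ tabulate-cong (λ i → unbit∘bit (lookup J i)) ⟩
  tabulate (lookup J)
    ≡⟨ tabulate∘lookup J ⟩
  J ∎
  where open ≡-Reasoning

∘↪ : ∀ {A B G} → B ↪ G → A ↪ B → A ↪ G
∘↪ f g = record
  { map   = λ x → _↪_.map f (_↪_.map g x)
  ; inj   = λ e → _↪_.inj g (_↪_.inj f e)
  ; edges = λ e → _↪_.edges f (_↪_.edges g e)
  }

unbounded-subdivisions : (lem : ∀ {ℓ : Level} → ExcludedMiddle ℓ) (C : Class) (r : ℕ) →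
  ¬ (Σ[ m ∈ ℕ ] (∀ G → C G → ¬ (K m r ↪ G))) → ∀ m → Σ[ G ∈ Graph ] (C G × K m r ↪ G)
unbounded-subdivisions lem C r notFlat m with lem {P = Σ[ G ∈ Graph ] (C G × K m r ↪ G)}
... | yes found = found
... | no none    = ⊥-elim (notFlat (m , λ G cG e → none (G , cG , e)))

reach-has-IP : (C : Class) → SubgraphClosed C → (r : ℕ) →
               (∀ m → Σ[ G ∈ Graph ] (C G × K m r ↪ G)) → HasIP C 1 1 (reachF r)
reach-has-IP C subc r host n =
  KR r , member , a , b , λ i J → mk⇔ (to i J) (from i J)
  where
  Mem : Fin n → Fin (2 ^ n) → Set
  Mem i c = i ∈ decode c
  open Pruned (Bipartite Mem)
  member : C (KR r)
  member = let (G , cG , K↪G) = host (n + 2 ^ n) in subc G (KR r) cG (∘↪ K↪G (KR↪K r))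
  a : Fin n → Fin 1 → KV (n + 2 ^ n) r
  a i _ = prin (i ↑ˡ 2 ^ n)
  b : Subset n → Fin 1 → KV (n + 2 ^ n) r
  b J _ = prin (n ↑ʳ encode J)
  to : ∀ i J → Sat (KR r) (a i VF.++ b J) (reachF r) → i ∈ J
  to i J s = subst (i ∈_) (decode-encode J)
    (bipartite⇒rel Mem i (encode J)
      (kept-of-reach (left-source Mem i) (Equivalence.to (sat-reach (KR r) r (a i VF.++ b J)) s)))
  from : ∀ i J → i ∈ J → Sat (KR r) (a i VF.++ b J) (reachF r)
  from i J i∈J = Equivalence.from (sat-reach (KR r) r (a i VF.++ b J))
    (reach-of-kept (left<right i (encode J)) (i , encode J , refl , refl , subst (i ∈_) (sym (decode-encode J)) i∈J))

lemma5p1 : (lem : ∀ {ℓ : Level} → ExcludedMiddle ℓ) →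
    (C : Class) → IsoClosed C → SubgraphClosed C →
    Dependent C → Superflat C
lemma5p1 lem C _ subc dep r with lem {P = Σ[ m ∈ ℕ ] (∀ G → C G → ¬ (K m r ↪ G))}
... | yes flatAt-r = flatAt-r
... | no notFlat   = ⊥-elim (dep 1 1 (reachF r)
                      (reach-has-IP C subc r (unbounded-subdivisions lem C r notFlat)))
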